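{- Let $p>2$ be a prime and let $n$ be an even positive integer, written $n=p^r k$ with $r=v_p(n)$ (so $p\nmid k$). A tuple $\mathbf{a}\in\mathbf{Z}_p^n$ belongs to a cycle of $T$ if and only if it is $r$-even, i.e. $\sigma_j(\mathbf{a})=0$ for all $j=0,\dots,p^r-1$.
   Context: $\mathbf{Z}_p$ is the ring of integers modulo $p$; $T:\mathbf{Z}_p^n\to\mathbf{Z}_p^n$ is $T(a_0,\dots,a_{n-1})=(a_0+a_1,a_1+a_2,\dots,a_{n-2}+a_{n-1},a_{n-1}+a_0)$. A tuple $\mathbf{a}$ belongs to a cycle if $T^{j}\mathbf{a}=\mathbf{a}$ for some positive integer $j$. $v_p(n)$ is the exponent of the largest power of $p$ dividing $n$. For $n=p^rk$ and $j=0,\dots,p^r-1$, $\sigma_j(\mathbf{a})=\sum_{i=0}^{k-1}(-1)^i a_{p^r i+j}\bmod p$. -}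

module Defs where

open import Data.Nat using (ℕ; zero; suc; _+_; _*_; _^_; NonZero)
open import Data.Nat.DivMod using (_mod_)
open import Data.Fin using (Fin; toℕ)
open import Data.Integer as ℤ using (ℤ; +_)

-- Z_p is represented by Fin p (residues 0..p-1), addition mod p.
-- A tuple in Z_p^n is a function Fin n → Fin p (indices 0..n-1).

Tuple : (p n : ℕ) → Set
Tuple p n = Fin n → Fin p

sucMod : (n : ℕ) → .{{_ : NonZero n}} → Fin n → Fin n
sucMod n i = (suc (toℕ i)) mod n

T : (p n : ℕ) → .{{_ : NonZero p}} → .{{_ : NonZero n}} → Tuple p n → Tuple p n
T p n a i = (toℕ (a i) + toℕ (a (sucMod n i))) mod p

iterT : (p n : ℕ) → .{{_ : NonZero p}} → .{{_ : NonZero n}} → ℕ → Tuple p n → Tuple p n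
iterT p n zero    a = a
iterT p n (suc j) a = T p n (iterT p n j a)

InCycle : (p n : ℕ) → .{{_ : NonZero p}} → .{{_ : NonZero n}} → Tuple p n → Set
InCycle p n a = Σ ℕ λ j → (0 Data.Nat.< j) × (∀ i → iterT p n j a i ≡ a i)
  where
  open import Data.Product using (Σ; _×_)
  open import Relation.Binary.PropositionalEquality using (_≡_)
  import Data.Nat

sgn : ℕ → ℤ
sgn zero = + 1
sgn (suc i) = ℤ.- sgn i

sumℤ : ℕ → (ℕ → ℤ) → ℤ
sumℤ zero    f = + 0
sumℤ (suc k) f = sumℤ k f ℤ.+ f k

-- σ_j(a) = Σ_{i<k} (-1)^i a_{p^r i + j}, as an integer (to be read mod p).
-- The index p^r i + j is < n in the intended range; it is reduced mod n only to land in Fin n.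
σ : (p n : ℕ) → .{{_ : NonZero n}} → (r k j : ℕ) → Tuple p n → ℤ
σ p n r k j a = sumℤ k (λ i → sgn i ℤ.* (+ toℕ (a (((p ^ r) * i + j) mod n))))

{-# OPTIONS --safe #-}
module Submission where

-- A tuple is read as an n-periodic integer sequence g, on which T acts as 1 + S
-- for the shift S.  Modulo p, (1 + S)^p = 1 + S^p (the interior binomial
-- coefficients vanish), hence (1 + S)^(p^r) = 1 + S^(p^r).  A tuple on a cycle is
-- T^(p^r) of another tuple h, and σ_j((1 + S^(p^r)) h) telescopes to
-- h_j - (-1)^k h_(j+n) = 0 because k is even.  Conversely T keeps the r-even tuples
-- r-even (σ_(p^r) = -σ_0) and is injective on them: a difference killed by 1 + S is
-- x ↦ (-1)^x c, whose σ_0 is k c since p^r is odd, and p ∤ k forces c = 0.  An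
-- injective self-map of the finite set of r-even tuples puts every one on a cycle.

open import Defs

open import Data.Fin using (Fin; toℕ; funToFin; finToFun)
import Data.Fin.Properties as Fin
open import Data.Integer as ℤ using (ℤ; +_; _+_; _*_; -_; _-_; 0ℤ; 1ℤ; -1ℤ)
open import Data.Integer.Divisibility as ℤD using ()
open import Data.Integer.Divisibility.Signed as S using ()
import Data.Integer.Properties as ℤ
open import Algebra.Properties.AbelianGroup ℤ.+-0-abelianGroup
  using () renaming (inverseʳ-unique to +-inverseʳ-unique)
open import Data.Integer.Tactic.RingSolver using (solve-∀)
open import Data.Nat as ℕ using (ℕ; zero; suc; _^_; NonZero; z≤n; s≤s)
open import Data.Nat.Combinatorics using (_C_; nCn≡1; nC1≡n; nCk+nC[k+1]≡[n+1]C[k+1]; k>n⇒nCk≡0)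
open import Data.Nat.Divisibility as ℕ using (divides; >⇒∤; ∣m∣n⇒∣m+n; ∣-refl)
open import Data.Nat.DivMod using (_mod_)
import Data.Nat.DivMod as DM
open import Data.Nat.GeneralisedArithmetic using (fold; fold-+)
open import Data.Nat.Primality using (Prime; prime⇒nonZero; euclidsLemma; prime⇒irreducible; prime[2])
import Data.Nat.Properties as ℕ
import Data.Nat.Tactic.RingSolver as ℕ-Solver
open import Data.Product using (_,_)
open import Data.Sum using (inj₁; inj₂)
open import Function using (_∘_)
open import Function.Bundles using (_⇔_; mk⇔; Equivalence)
open import Level using (0ℓ)
open import Relation.Binary.Bundles using (Setoid)
import Relation.Binary.Reasoning.Setoid as SetoidReasoning
open import Relation.Binary.PropositionalEquality
open import Relation.Nullary using (¬_; contradiction)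

sumℤ-cong : ∀ k {f g : ℕ → ℤ} → (∀ i → f i ≡ g i) → sumℤ k f ≡ sumℤ k g
sumℤ-cong zero    f≡g = refl
sumℤ-cong (suc k) f≡g = cong₂ _+_ (sumℤ-cong k f≡g) (f≡g k)

sumℤ-distrib-+ : ∀ k (f g : ℕ → ℤ) → sumℤ k (λ i → f i + g i) ≡ sumℤ k f + sumℤ k g
sumℤ-distrib-+ zero    f g = refl
sumℤ-distrib-+ (suc k) f g rewrite sumℤ-distrib-+ k f g = interchange (sumℤ k f) (sumℤ k g) (f k) (g k)
  where
  interchange : ∀ a b c d → a + b + (c + d) ≡ a + c + (b + d)
  interchange = solve-∀

sumℤ-neg : ∀ k (f : ℕ → ℤ) → sumℤ k (-_ ∘ f) ≡ - sumℤ k f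
sumℤ-neg zero    f = refl
sumℤ-neg (suc k) f rewrite sumℤ-neg k f = sym (ℤ.neg-distrib-+ (sumℤ k f) (f k))

sumℤ-const : ∀ k c → sumℤ k (λ _ → c) ≡ + k * c
sumℤ-const zero    c = sym (ℤ.*-zeroˡ c)
sumℤ-const (suc k) c rewrite sumℤ-const k c = step (+ k) c
  where
  step : ∀ k c → k * c + c ≡ (1ℤ + k) * c
  step = solve-∀

sumℤ-suc : ∀ k (f : ℕ → ℤ) → sumℤ (suc k) f ≡ f 0 + sumℤ k (f ∘ suc)
sumℤ-suc zero    f = ℤ.+-comm 0ℤ (f 0)
sumℤ-suc (suc k) f rewrite sumℤ-suc k f = ℤ.+-assoc (f 0) _ _

sumℤ-telescope : ∀ k (h : ℕ → ℤ) → sumℤ k (λ i → sgn i * (h i + h (suc i))) ≡ h 0 - sgn k * h k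
sumℤ-telescope zero    h = sym (trans (cong (_-_ (h 0)) (ℤ.*-identityˡ (h 0))) (ℤ.+-inverseʳ (h 0)))
sumℤ-telescope (suc k) h rewrite sumℤ-telescope k h = step (h 0) (sgn k) (h k) (h (suc k))
  where
  step : ∀ a s x y → a - s * x + s * (x + y) ≡ a - (- s) * y
  step = solve-∀

sgn-+ : ∀ m n → sgn (m ℕ.+ n) ≡ sgn m * sgn n
sgn-+ zero    n = sym (ℤ.*-identityˡ (sgn n))
sgn-+ (suc m) n rewrite sgn-+ m n = ℤ.neg-distribˡ-* (sgn m) (sgn n)

sgn*sgn≡1 : ∀ n → sgn n * sgn n ≡ 1ℤ
sgn*sgn≡1 zero    = refl
sgn*sgn≡1 (suc n) = trans (neg*neg (sgn n)) (sgn*sgn≡1 n)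
  where
  neg*neg : ∀ s → - s * - s ≡ s * s
  neg*neg = solve-∀

sgn-*-odd : ∀ m → sgn m ≡ -1ℤ → ∀ i → sgn (m ℕ.* i) ≡ sgn i
sgn-*-odd m sgn[m]≡-1 zero    = cong sgn (ℕ.*-zeroʳ m)
sgn-*-odd m sgn[m]≡-1 (suc i) = begin
  sgn (m ℕ.* suc i)         ≡⟨ cong sgn (ℕ.*-suc m i) ⟩
  sgn (m ℕ.+ m ℕ.* i)       ≡⟨ sgn-+ m (m ℕ.* i) ⟩
  sgn m * sgn (m ℕ.* i)     ≡⟨ cong₂ _*_ sgn[m]≡-1 (sgn-*-odd m sgn[m]≡-1 i) ⟩
  -1ℤ * sgn i               ≡⟨ ℤ.-1*i≡-i (sgn i) ⟩
  sgn (suc i)               ∎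
  where open ≡-Reasoning

2∣⇒sgn≡1 : ∀ {n} → 2 ℕ.∣ n → sgn n ≡ 1ℤ
2∣⇒sgn≡1 (divides q refl) = sgn[q*2] q
  where
  sgn[q*2] : ∀ q → sgn (q ℕ.* 2) ≡ 1ℤ
  sgn[q*2] zero    = refl
  sgn[q*2] (suc q) = trans (ℤ.neg-involutive _) (sgn[q*2] q)

2∤⇒sgn≡-1 : ∀ n → ¬ 2 ℕ.∣ n → sgn n ≡ -1ℤ
2∤⇒sgn≡-1 zero          2∤n = contradiction (divides 0 refl) 2∤n
2∤⇒sgn≡-1 (suc zero)    2∤n = refl
2∤⇒sgn≡-1 (suc (suc n)) 2∤n = trans (ℤ.neg-involutive _) (2∤⇒sgn≡-1 n (2∤n ∘ ∣m∣n⇒∣m+n ∣-refl))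

odd-prime-power : ∀ {p} → Prime p → 2 ℕ.< p → ∀ r → ¬ 2 ℕ.∣ p ^ r
odd-prime-power pr 2<p zero    2∣1 = contradiction (ℕ.∣⇒≤ 2∣1) λ { (s≤s ()) }
odd-prime-power {p} pr 2<p (suc r) 2∣p^[1+r] with euclidsLemma p (p ^ r) prime[2] 2∣p^[1+r]
... | inj₂ 2∣p^r = odd-prime-power pr 2<p r 2∣p^r
... | inj₁ 2∣p with prime⇒irreducible pr 2∣p
...   | inj₁ ()
...   | inj₂ refl = ℕ.<-irrefl refl 2<p

C-absorption : ∀ n k → suc k ℕ.* (suc n C suc k) ≡ suc n ℕ.* (n C k)
C-absorption n       zero    = trans (ℕ.*-identityˡ _) (trans (nC1≡n (suc n)) (sym (ℕ.*-identityʳ (suc n))))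
C-absorption zero    (suc k) = ℕ.*-zeroʳ (suc (suc k))
C-absorption (suc n) (suc k) = begin
  suc (suc k) ℕ.* (suc (suc n) C suc (suc k))
    ≡⟨ cong (suc (suc k) ℕ.*_) (sym (nCk+nC[k+1]≡[n+1]C[k+1] (suc n) (suc k))) ⟩
  suc (suc k) ℕ.* (x ℕ.+ y)
    ≡⟨ split (suc k) x y ⟩
  suc k ℕ.* x ℕ.+ x ℕ.+ (y ℕ.+ suc k ℕ.* y)
    ≡⟨ cong₂ (λ u v → u ℕ.+ x ℕ.+ v) (C-absorption n k) (C-absorption n (suc k)) ⟩
  suc n ℕ.* (n C k) ℕ.+ x ℕ.+ suc n ℕ.* (n C suc k)
    ≡⟨ cong (λ u → suc n ℕ.* (n C k) ℕ.+ u ℕ.+ suc n ℕ.* (n C suc k)) (sym (nCk+nC[k+1]≡[n+1]C[k+1] n k)) ⟩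
  suc n ℕ.* (n C k) ℕ.+ (n C k ℕ.+ n C suc k) ℕ.+ suc n ℕ.* (n C suc k)
    ≡⟨ merge (suc n) (n C k) (n C suc k) ⟩
  suc (suc n) ℕ.* (n C k ℕ.+ n C suc k)
    ≡⟨ cong (suc (suc n) ℕ.*_) (nCk+nC[k+1]≡[n+1]C[k+1] n k) ⟩
  suc (suc n) ℕ.* (suc n C suc k) ∎
  where
  open ≡-Reasoning
  x = suc n C suc k
  y = suc n C suc (suc k)
  split : ∀ k x y → suc k ℕ.* (x ℕ.+ y) ≡ k ℕ.* x ℕ.+ x ℕ.+ (y ℕ.+ k ℕ.* y)
  split = ℕ-Solver.solve-∀
  merge : ∀ n a b → n ℕ.* a ℕ.+ (a ℕ.+ b) ℕ.+ n ℕ.* b ≡ suc n ℕ.* (a ℕ.+ b)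
  merge = ℕ-Solver.solve-∀

prime∣C : ∀ {p} → Prime p → ∀ k → 0 ℕ.< k → k ℕ.< p → p ℕ.∣ p C k
prime∣C {suc n} pr (suc k) _ k<p
  with euclidsLemma (suc k) (suc n C suc k) pr (divides (n C k) (trans (C-absorption n k) (ℕ.*-comm (suc n) (n C k))))
... | inj₁ p∣k = contradiction p∣k (>⇒∤ k<p)
... | inj₂ p∣C = p∣C

∣m⊖n∣≡∣m-n∣ : ∀ m n → ℤ.∣ m ℤ.⊖ n ∣ ≡ ℕ.∣ m - n ∣
∣m⊖n∣≡∣m-n∣ zero    zero    = refl
∣m⊖n∣≡∣m-n∣ zero    (suc n) = refl
∣m⊖n∣≡∣m-n∣ (suc m) zero    = refl
∣m⊖n∣≡∣m-n∣ (suc m) (suc n) = trans (cong ℤ.∣_∣ (ℤ.[1+m]⊖[1+n]≡m⊖n m n)) (∣m⊖n∣≡∣m-n∣ m n)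

Seq : Set
Seq = ℕ → ℤ

addShift : ℕ → Seq → Seq
addShift d g x = g x + g (x ℕ.+ d)

Periodic : ℕ → Seq → Set
Periodic N g = ∀ x → g (x ℕ.+ N) ≡ g x

addShift-periodic : ∀ {N} d {g} → Periodic N g → Periodic N (addShift d g)
addShift-periodic {N} d {g} g-per x =
  cong₂ _+_ (g-per x) (trans (cong g (swap x N d)) (g-per (x ℕ.+ d)))
  where
  swap : ∀ x N d → x ℕ.+ N ℕ.+ d ≡ x ℕ.+ d ℕ.+ N
  swap = ℕ-Solver.solve-∀

fold-preserves : ∀ {A : Set} (P : A → Set) {s : A → A} → (∀ {a} → P a → P (s a)) →
                 ∀ {z} → P z → ∀ t → P (fold z s t)
fold-preserves P s-pres Pz zero    = Pz
fold-preserves P s-pres Pz (suc t) = s-pres (fold-preserves P s-pres Pz t)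

fold-*-nested : ∀ {A : Set} (z : A) (s : A → A) m n → fold z s (m ℕ.* n) ≡ fold z (λ y → fold y s n) m
fold-*-nested z s zero    n = refl
fold-*-nested z s (suc m) n = trans (fold-+ z s n) (cong (λ y → fold y s n) (fold-*-nested z s m n))

sumℤ-pascal : ∀ t (h : ℕ → ℤ) →
  sumℤ (suc (suc t)) (λ s → + (suc t C s) * h s) ≡
  sumℤ (suc t) (λ s → + (t C s) * h s) + sumℤ (suc t) (λ s → + (t C s) * h (suc s))
sumℤ-pascal t h = begin
  sumℤ (suc (suc t)) (λ s → + (suc t C s) * h s)
    ≡⟨ sumℤ-suc (suc t) _ ⟩
  1ℤ * h 0 + sumℤ (suc t) (λ s → + (suc t C suc s) * h (suc s))
    ≡⟨ cong (_+_ (1ℤ * h 0)) (trans (sumℤ-cong (suc t) pascal) (sumℤ-distrib-+ (suc t) _ _)) ⟩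
  1ℤ * h 0 + (A + B)
    ≡⟨ regroup (1ℤ * h 0) A B ⟩
  (1ℤ * h 0 + B) + A
    ≡⟨ cong (_+ A) (sym (sumℤ-suc (suc t) λ s → + (t C s) * h s)) ⟩
  sumℤ (suc t) (λ s → + (t C s) * h s) + + (t C suc t) * h (suc t) + A
    ≡⟨ cong (λ c → sumℤ (suc t) (λ s → + (t C s) * h s) + + c * h (suc t) + A) (k>n⇒nCk≡0 (ℕ.n<1+n t)) ⟩
  sumℤ (suc t) (λ s → + (t C s) * h s) + 0ℤ + A
    ≡⟨ cong (_+ A) (ℤ.+-identityʳ (sumℤ (suc t) (λ s → + (t C s) * h s))) ⟩
  sumℤ (suc t) (λ s → + (t C s) * h s) + A ∎
  where
  open ≡-Reasoning
  A = sumℤ (suc t) (λ s → + (t C s) * h (suc s))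
  B = sumℤ (suc t) (λ s → + (t C suc s) * h (suc s))
  pascal : ∀ s → + (suc t C suc s) * h (suc s) ≡ + (t C s) * h (suc s) + + (t C suc s) * h (suc s)
  pascal s = trans (cong (λ c → + c * h (suc s)) (sym (nCk+nC[k+1]≡[n+1]C[k+1] t s)))
                   (trans (cong (_* h (suc s)) (ℤ.pos-+ (t C s) (t C suc s)))
                          (ℤ.*-distribʳ-+ (h (suc s)) (+ (t C s)) (+ (t C suc s))))
  regroup : ∀ a x y → a + (x + y) ≡ (a + y) + x
  regroup = solve-∀

fold-addShift : ∀ d g t x → fold g (addShift d) t x ≡ sumℤ (suc t) (λ s → + (t C s) * g (x ℕ.+ s ℕ.* d))
fold-addShift d g zero    x = sym (trans (ℤ.+-identityˡ _) (trans (ℤ.*-identityˡ _) (cong g (ℕ.+-identityʳ x))))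
fold-addShift d g (suc t) x = begin
  fold g (addShift d) t x + fold g (addShift d) t (x ℕ.+ d)
    ≡⟨ cong₂ _+_ (fold-addShift d g t x) (fold-addShift d g t (x ℕ.+ d)) ⟩
  sumℤ (suc t) (λ s → + (t C s) * g (x ℕ.+ s ℕ.* d)) +
  sumℤ (suc t) (λ s → + (t C s) * g (x ℕ.+ d ℕ.+ s ℕ.* d))
    ≡⟨ cong (_+_ (sumℤ (suc t) (λ s → + (t C s) * g (x ℕ.+ s ℕ.* d))))
            (sumℤ-cong (suc t) λ s → cong (λ y → + (t C s) * g y) (ℕ.+-assoc x d (s ℕ.* d))) ⟩
  sumℤ (suc t) (λ s → + (t C s) * g (x ℕ.+ s ℕ.* d)) +
  sumℤ (suc t) (λ s → + (t C s) * g (x ℕ.+ suc s ℕ.* d))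
    ≡⟨ sym (sumℤ-pascal t (λ s → g (x ℕ.+ s ℕ.* d))) ⟩
  sumℤ (suc (suc t)) (λ s → + (suc t C s) * g (x ℕ.+ s ℕ.* d)) ∎
  where open ≡-Reasoning

toℕ-mod : ∀ {d} .{{_ : NonZero d}} x → toℕ (x mod d) ≡ x ℕ.% d
toℕ-mod x = Fin.toℕ-fromℕ< _

module Congruence (d : ℕ) where

  infix 4 _≈_
  record _≈_ (x y : ℤ) : Set where
    constructor ∣⇒≈
    field ≈⇒∣ : + d S.∣ x - y

  ≈-refl : ∀ {x} → x ≈ x
  ≈-refl {x} = ∣⇒≈ (subst (+ d S.∣_) (sym (ℤ.+-inverseʳ x)) (S.divides 0ℤ refl))

  ≈-reflexive : ∀ {x y} → x ≡ y → x ≈ y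
  ≈-reflexive refl = ≈-refl

  ≈-sym : ∀ {x y} → x ≈ y → y ≈ x
  ≈-sym {x} {y} (∣⇒≈ d∣x-y) = ∣⇒≈ (subst (+ d S.∣_) (neg[x-y] x y) (S.∣m⇒∣-m d∣x-y))
    where
    neg[x-y] : ∀ x y → - (x - y) ≡ y - x
    neg[x-y] = solve-∀

  ≈-trans : ∀ {x y z} → x ≈ y → y ≈ z → x ≈ z
  ≈-trans {x} {y} {z} (∣⇒≈ d∣x-y) (∣⇒≈ d∣y-z) =
    ∣⇒≈ (subst (+ d S.∣_) (chain x y z) (S.∣m∣n⇒∣m+n d∣x-y d∣y-z))
    where
    chain : ∀ x y z → x - y + (y - z) ≡ x - z
    chain = solve-∀

  ≈-setoid : Setoid 0ℓ 0ℓ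
  ≈-setoid = record
    { Carrier       = ℤ
    ; _≈_           = _≈_
    ; isEquivalence = record { refl = ≈-refl ; sym = ≈-sym ; trans = ≈-trans }
    }

  +-cong : ∀ {x y u v} → x ≈ y → u ≈ v → x + u ≈ y + v
  +-cong {x} {y} {u} {v} (∣⇒≈ d∣x-y) (∣⇒≈ d∣u-v) =
    ∣⇒≈ (subst (+ d S.∣_) (regroup x y u v) (S.∣m∣n⇒∣m+n d∣x-y d∣u-v))
    where
    regroup : ∀ x y u v → x - y + (u - v) ≡ x + u - (y + v)
    regroup = solve-∀

  -‿cong : ∀ {x y} → x ≈ y → - x ≈ - y
  -‿cong {x} {y} (∣⇒≈ d∣x-y) = ∣⇒≈ (subst (+ d S.∣_) (regroup x y) (S.∣m⇒∣-m d∣x-y))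
    where
    regroup : ∀ x y → - (x - y) ≡ - x - - y
    regroup = solve-∀

  *-congˡ : ∀ c {x y} → x ≈ y → c * x ≈ c * y
  *-congˡ c {x} {y} (∣⇒≈ d∣x-y) = ∣⇒≈ (subst (+ d S.∣_) (distrib c x y) (S.∣n⇒∣m*n c d∣x-y))
    where
    distrib : ∀ c x y → c * (x - y) ≡ c * x - c * y
    distrib = solve-∀

  n*d≈0 : ∀ n → n * + d ≈ 0ℤ
  n*d≈0 n = ∣⇒≈ (S.divides n (ℤ.+-identityʳ (n * + d)))

  ≈0⇔∣ : ∀ {x} → x ≈ 0ℤ ⇔ + d ℤD.∣ x
  ≈0⇔∣ {x} = mk⇔ (λ (∣⇒≈ d∣x-0) → S.∣⇒∣ᵤ (subst (+ d S.∣_) (ℤ.+-identityʳ x) d∣x-0))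
                 (λ d∣x → ∣⇒≈ (subst (+ d S.∣_) (sym (ℤ.+-identityʳ x)) (S.∣ᵤ⇒∣ d∣x)))

  module ≈-Reasoning = SetoidReasoning ≈-setoid

  sumℤ-cong≈ : ∀ k {f g : ℕ → ℤ} → (∀ i → i ℕ.< k → f i ≈ g i) → sumℤ k f ≈ sumℤ k g
  sumℤ-cong≈ zero    f≈g = ≈-refl
  sumℤ-cong≈ (suc k) f≈g = +-cong (sumℤ-cong≈ k (λ i i<k → f≈g i (ℕ.m<n⇒m<1+n i<k))) (f≈g k ℕ.≤-refl)

  sumℤ-ends : ∀ t (f : ℕ → ℤ) → (∀ i → i ℕ.< t → f (suc i) ≈ 0ℤ) →
              sumℤ (suc (suc t)) f ≈ f 0 + f (suc t)
  sumℤ-ends t f interior≈0 = begin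
    sumℤ (suc t) f + f (suc t)
      ≡⟨ cong (_+ f (suc t)) (sumℤ-suc t f) ⟩
    f 0 + sumℤ t (f ∘ suc) + f (suc t)
      ≈⟨ +-cong (+-cong (≈-refl {f 0}) (sumℤ-cong≈ t interior≈0)) (≈-refl {f (suc t)}) ⟩
    f 0 + sumℤ t (λ _ → 0ℤ) + f (suc t)
      ≡⟨ cong (λ z → f 0 + z + f (suc t)) (trans (sumℤ-const t 0ℤ) (ℤ.*-zeroʳ (+ t))) ⟩
    f 0 + 0ℤ + f (suc t)
      ≡⟨ cong (_+ f (suc t)) (ℤ.+-identityʳ (f 0)) ⟩
    f 0 + f (suc t) ∎
    where open ≈-Reasoning

  +[m%d]≈+m : .{{_ : NonZero d}} → ∀ m → + (m ℕ.% d) ≈ + m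
  +[m%d]≈+m m = ≈-sym (∣⇒≈ (S.divides (+ q) (begin
    + m - + r                ≡⟨ cong (λ z → + z - + r) (DM.m≡m%n+[m/n]*n m d) ⟩
    + (r ℕ.+ q ℕ.* d) - + r  ≡⟨ cong (_- + r) (trans (ℤ.pos-+ r (q ℕ.* d)) (cong (_+_ (+ r)) (ℤ.pos-* q d))) ⟩
    + r + + q * + d - + r    ≡⟨ cancel (+ r) (+ q * + d) ⟩
    + q * + d                ∎)))
    where
    open ≡-Reasoning
    r = m ℕ.% d
    q = m ℕ./ d
    cancel : ∀ r s → r + s - r ≡ s
    cancel = solve-∀

  +-≈-injective : .{{_ : NonZero d}} → ∀ {x y} → x ℕ.< d → y ℕ.< d → + x ≈ + y → x ≡ y
  +-≈-injective {x} {y} x<d y<d (∣⇒≈ d∣x-y) =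
    ℕ.∣m-n∣≡0⇒m≡n (small-multiple≡0 ∣x-y∣<d d∣∣x-y∣)
    where
    d∣∣x-y∣ : d ℕ.∣ ℕ.∣ x - y ∣
    d∣∣x-y∣ = subst (d ℕ.∣_) (trans (cong ℤ.∣_∣ (ℤ.m-n≡m⊖n x y)) (∣m⊖n∣≡∣m-n∣ x y))
                    (S.∣⇒∣ᵤ d∣x-y)
    ∣x-y∣<d : ℕ.∣ x - y ∣ ℕ.< d
    ∣x-y∣<d = ℕ.≤-<-trans (ℕ.∣m-n∣≤m⊔n x y) (ℕ.⊔-lub x<d y<d)
    small-multiple≡0 : ∀ {z} → z ℕ.< d → d ℕ.∣ z → z ≡ 0
    small-multiple≡0 {z} z<d d∣z = trans (sym (DM.m<n⇒m%n≡m z<d)) (ℕ.n∣m⇒m%n≡0 z d d∣z)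

  *-cancelˡ-≈0 : Prime d → ∀ {k} → ¬ d ℕ.∣ k → ∀ c → + k * c ≈ 0ℤ → c ≈ 0ℤ
  *-cancelˡ-≈0 pr {k} d∤k c kc≈0
    with euclidsLemma k ℤ.∣ c ∣ pr (subst (d ℕ.∣_) (ℤ.abs-* (+ k) c) (Equivalence.to ≈0⇔∣ kc≈0))
  ... | inj₁ d∣k = contradiction d∣k d∤k
  ... | inj₂ d∣c = Equivalence.from ≈0⇔∣ d∣c

  x≈y⇒x-y≈0 : ∀ {x y} → x ≈ y → x - y ≈ 0ℤ
  x≈y⇒x-y≈0 {x} {y} (∣⇒≈ d∣x-y) = ∣⇒≈ (subst (+ d S.∣_) (sym (ℤ.+-identityʳ (x - y))) d∣x-y)

  x-y≈0⇒x≈y : ∀ {x y} → x - y ≈ 0ℤ → x ≈ y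
  x-y≈0⇒x≈y {x} {y} (∣⇒≈ d∣x-y-0) = ∣⇒≈ (subst (+ d S.∣_) (ℤ.+-identityʳ (x - y)) d∣x-y-0)

  infix 4 _≋_
  _≋_ : Seq → Seq → Set
  g ≋ h = ∀ x → g x ≈ h x

  ≋-refl : ∀ {g} → g ≋ g
  ≋-refl x = ≈-refl

  ≋-sym : ∀ {g h} → g ≋ h → h ≋ g
  ≋-sym g≋h x = ≈-sym (g≋h x)

  ≋-trans : ∀ {g h u} → g ≋ h → h ≋ u → g ≋ u
  ≋-trans g≋h h≋u x = ≈-trans (g≋h x) (h≋u x)

  Congruent : (Seq → Seq) → Set
  Congruent B = ∀ {g h} → g ≋ h → B g ≋ B h

  addShift-congruent : ∀ e → Congruent (addShift e)
  addShift-congruent e g≋h x = +-cong (g≋h x) (g≋h (x ℕ.+ e))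

  fold-congruent : ∀ {B} → Congruent B → ∀ t → Congruent (λ g → fold g B t)
  fold-congruent B-cong zero    g≋h = g≋h
  fold-congruent B-cong (suc t) g≋h = B-cong (fold-congruent B-cong t g≋h)

  fold-cong-≋ : ∀ {B B′} → Congruent B′ → (∀ g → B g ≋ B′ g) → ∀ g t → fold g B t ≋ fold g B′ t
  fold-cong-≋ B′-cong B≋B′ g zero    = ≋-refl
  fold-cong-≋ B′-cong B≋B′ g (suc t) = ≋-trans (B≋B′ _) (B′-cong (fold-cong-≋ B′-cong B≋B′ g t))

  fold-cycle : ∀ {B} → Congruent B → ∀ {g} J → g ≋ fold g B J → ∀ t → g ≋ fold g B (t ℕ.* J)
  fold-cycle B-cong J g≋BJg zero    = ≋-refl
  fold-cycle {B} B-cong {g} J g≋BJg (suc t) rewrite fold-+ g B J {t ℕ.* J} =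
    ≋-trans g≋BJg (fold-congruent B-cong J (fold-cycle B-cong J g≋BJg t))

  fold-addShift-≈ : ∀ e g t → 0 ℕ.< t → (∀ s → 0 ℕ.< s → s ℕ.< t → d ℕ.∣ t C s) →
                    fold g (addShift e) t ≋ addShift (t ℕ.* e) g
  fold-addShift-≈ e g (suc t) _ d∣C x = begin
    fold g (addShift e) (suc t) x
      ≡⟨ fold-addShift e g (suc t) x ⟩
    sumℤ (suc (suc t)) f
      ≈⟨ sumℤ-ends t f interior≈0 ⟩
    f 0 + f (suc t)
      ≡⟨ cong₂ _+_ (trans (ℤ.*-identityˡ _) (cong g (ℕ.+-identityʳ x)))
                   (trans (cong (λ c → + c * g (x ℕ.+ suc t ℕ.* e)) (nCn≡1 (suc t))) (ℤ.*-identityˡ _)) ⟩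
    addShift (suc t ℕ.* e) g x ∎
    where
    open ≈-Reasoning
    f : ℕ → ℤ
    f s = + (suc t C s) * g (x ℕ.+ s ℕ.* e)
    interior≈0 : ∀ i → i ℕ.< t → f (suc i) ≈ 0ℤ
    interior≈0 i i<t with d∣C (suc i) (s≤s z≤n) (s≤s i<t)
    ... | divides c C≡c*d = begin
      + (suc t C suc i) * g (x ℕ.+ suc i ℕ.* e)  ≡⟨ cong (λ n → + n * g (x ℕ.+ suc i ℕ.* e)) C≡c*d ⟩
      + (c ℕ.* d) * g (x ℕ.+ suc i ℕ.* e)        ≡⟨ cong (_* g (x ℕ.+ suc i ℕ.* e)) (ℤ.pos-* c d) ⟩
      + c * + d * g (x ℕ.+ suc i ℕ.* e)          ≡⟨ swap (+ c) (+ d) _ ⟩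
      + c * g (x ℕ.+ suc i ℕ.* e) * + d          ≈⟨ n*d≈0 (+ c * g (x ℕ.+ suc i ℕ.* e)) ⟩
      0ℤ                                          ∎
      where
      swap : ∀ a b y → a * b * y ≡ a * y * b
      swap = solve-∀

  alternating : ∀ (δ : Seq) → (∀ x → δ x + δ (x ℕ.+ 1) ≈ 0ℤ) → ∀ x → δ x ≈ sgn x * δ 0
  alternating δ δ-anti zero    = ≈-reflexive (sym (ℤ.*-identityˡ (δ 0)))
  alternating δ δ-anti (suc x) = begin
    δ (suc x)                    ≡⟨ cong δ (ℕ.+-comm 1 x) ⟩
    δ (x ℕ.+ 1)                  ≡⟨ cancel (δ x) (δ (x ℕ.+ 1)) ⟨
    δ x + δ (x ℕ.+ 1) - δ x      ≈⟨ +-cong (δ-anti x) (≈-refl { - δ x}) ⟩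
    0ℤ - δ x                     ≡⟨ ℤ.+-identityˡ (- δ x) ⟩
    - δ x                        ≈⟨ -‿cong (alternating δ δ-anti x) ⟩
    - (sgn x * δ 0)              ≡⟨ ℤ.neg-distribˡ-* (sgn x) (δ 0) ⟩
    sgn (suc x) * δ 0            ∎
    where
    open ≈-Reasoning
    cancel : ∀ a b → a + b - a ≡ b
    cancel = solve-∀

  frobenius : Prime d → ∀ e g → fold g (addShift e) d ≋ addShift (d ℕ.* e) g
  frobenius pr e g = fold-addShift-≈ e g d (ℕ.>-nonZero⁻¹ d {{prime⇒nonZero pr}}) (prime∣C pr)

  frobenius-^ : Prime d → ∀ r g → fold g (addShift 1) (d ^ r) ≋ addShift (d ^ r) g
  frobenius-^ pr zero    g = ≋-refl
  frobenius-^ pr (suc r) g rewrite fold-*-nested g (addShift 1) d (d ^ r) =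
    ≋-trans (fold-cong-≋ (addShift-congruent (d ^ r)) (frobenius-^ pr r) g d) (frobenius pr (d ^ r) g)

module AlternatingSum (m k : ℕ) where

  altSum : ℕ → Seq → ℤ
  altSum j g = sumℤ k (λ i → sgn i * g (m ℕ.* i ℕ.+ j))

  altSum-addShift : ∀ e j g → altSum j (addShift e g) ≡ altSum j g + altSum (j ℕ.+ e) g
  altSum-addShift e j g = trans (sumℤ-cong k term) (sumℤ-distrib-+ k _ _)
    where
    term : ∀ i → sgn i * addShift e g (m ℕ.* i ℕ.+ j) ≡
                 sgn i * g (m ℕ.* i ℕ.+ j) + sgn i * g (m ℕ.* i ℕ.+ (j ℕ.+ e))
    term i = trans (ℤ.*-distribˡ-+ (sgn i) _ _)
                   (cong (λ y → sgn i * g (m ℕ.* i ℕ.+ j) + sgn i * g y) (ℕ.+-assoc (m ℕ.* i) j e))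

  altSum-addShift-period : sgn k ≡ 1ℤ → ∀ {h} → Periodic (m ℕ.* k) h →
                           ∀ j → altSum j (addShift m h) ≡ 0ℤ
  altSum-addShift-period sgn[k]≡1 {h} h-per j = begin
    altSum j (addShift m h)
      ≡⟨ sumℤ-cong k (λ i → cong (λ y → sgn i * (H i + h y)) (shift i)) ⟩
    sumℤ k (λ i → sgn i * (H i + H (suc i)))
      ≡⟨ sumℤ-telescope k H ⟩
    H 0 - sgn k * H k
      ≡⟨ cong₂ (λ u v → u - v * H k) (cong h (cong (ℕ._+ j) (ℕ.*-zeroʳ m))) sgn[k]≡1 ⟩
    h j - 1ℤ * H k
      ≡⟨ cong (λ y → h j - 1ℤ * y) (trans (cong h (ℕ.+-comm (m ℕ.* k) j)) (h-per j)) ⟩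
    h j - 1ℤ * h j
      ≡⟨ cong (λ y → h j - y) (ℤ.*-identityˡ (h j)) ⟩
    h j - h j
      ≡⟨ ℤ.+-inverseʳ (h j) ⟩
    0ℤ ∎
    where
    open ≡-Reasoning
    H : ℕ → ℤ
    H i = h (m ℕ.* i ℕ.+ j)
    shift : ∀ i → m ℕ.* i ℕ.+ j ℕ.+ m ≡ m ℕ.* suc i ℕ.+ j
    shift i = trans (rearrange (m ℕ.* i) j m) (cong (ℕ._+ j) (sym (ℕ.*-suc m i)))
      where
      rearrange : ∀ a j m → a ℕ.+ j ℕ.+ m ≡ m ℕ.+ a ℕ.+ j
      rearrange = ℕ-Solver.solve-∀

  altSum-antiperiodic : sgn k ≡ 1ℤ → ∀ {h} → Periodic (m ℕ.* k) h → altSum m h ≡ - altSum 0 h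
  altSum-antiperiodic sgn[k]≡1 {h} h-per =
    +-inverseʳ-unique _ _ (trans (sym (altSum-addShift m 0 h)) (altSum-addShift-period sgn[k]≡1 h-per 0))

  altSum-alternating : sgn m ≡ -1ℤ → ∀ c → altSum 0 (λ x → sgn x * c) ≡ + k * c
  altSum-alternating sgn[m]≡-1 c = trans (sumℤ-cong k term) (sumℤ-const k c)
    where
    open ≡-Reasoning
    term : ∀ i → sgn i * (sgn (m ℕ.* i ℕ.+ 0) * c) ≡ c
    term i = begin
      sgn i * (sgn (m ℕ.* i ℕ.+ 0) * c)  ≡⟨ cong (λ s → sgn i * (s * c)) sgn[m*i+0]≡sgn[i] ⟩
      sgn i * (sgn i * c)                ≡⟨ sym (ℤ.*-assoc (sgn i) (sgn i) c) ⟩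
      sgn i * sgn i * c                  ≡⟨ cong (_* c) (sgn*sgn≡1 i) ⟩
      1ℤ * c                             ≡⟨ ℤ.*-identityˡ c ⟩
      c                                  ∎
      where
      sgn[m*i+0]≡sgn[i] : sgn (m ℕ.* i ℕ.+ 0) ≡ sgn i
      sgn[m*i+0]≡sgn[i] = trans (cong sgn (ℕ.+-identityʳ (m ℕ.* i))) (sgn-*-odd m sgn[m]≡-1 i)

  altSum-sub : ∀ j g h → altSum j (λ x → g x - h x) ≡ altSum j g - altSum j h
  altSum-sub j g h =
    trans (sumℤ-cong k (λ i → ℤ.*-distribˡ-+ (sgn i) _ _))
          (trans (sumℤ-distrib-+ k _ _)
                 (cong (_+_ (altSum j g))
                       (trans (sumℤ-cong k (λ i → sym (ℤ.neg-distribʳ-* (sgn i) _))) (sumℤ-neg k _))))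

module Tuples (p n : ℕ) .{{_ : NonZero p}} .{{_ : NonZero n}} where
  open Congruence p

  lift : Tuple p n → Seq
  lift a x = + toℕ (a (x mod n))

  sucMod-mod : ∀ x → sucMod n (x mod n) ≡ suc x mod n
  sucMod-mod x = Fin.toℕ-injective (begin
    toℕ (sucMod n (x mod n))                    ≡⟨ toℕ-mod (suc (toℕ (x mod n))) ⟩
    suc (toℕ (x mod n)) ℕ.% n                   ≡⟨ cong (λ y → suc y ℕ.% n) (toℕ-mod x) ⟩
    suc (x ℕ.% n) ℕ.% n                         ≡⟨ DM.[m+kn]%n≡m%n (suc (x ℕ.% n)) (x ℕ./ n) n ⟨
    suc (x ℕ.% n ℕ.+ x ℕ./ n ℕ.* n) ℕ.% n      ≡⟨ cong (λ y → suc y ℕ.% n) (DM.m≡m%n+[m/n]*n x n) ⟨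
    suc x ℕ.% n                                 ≡⟨ toℕ-mod (suc x) ⟨
    toℕ (suc x mod n)                           ∎)
    where open ≡-Reasoning

  mod-toℕ : ∀ (i : Fin n) → toℕ i mod n ≡ i
  mod-toℕ i = Fin.toℕ-injective (trans (toℕ-mod (toℕ i)) (DM.m<n⇒m%n≡m (Fin.toℕ<n i)))

  lift-periodic : ∀ a → Periodic n (lift a)
  lift-periodic a x = cong (λ i → + toℕ (a i))
    (Fin.toℕ-injective (trans (toℕ-mod (x ℕ.+ n)) (trans (DM.[m+n]%n≡m%n x n) (sym (toℕ-mod x)))))

  lift-T : ∀ a → lift (T p n a) ≋ addShift 1 (lift a)
  lift-T a x = begin
    + toℕ ((u ℕ.+ v) mod p)   ≡⟨ cong +_ (toℕ-mod (u ℕ.+ v)) ⟩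
    + ((u ℕ.+ v) ℕ.% p)       ≈⟨ +[m%d]≈+m (u ℕ.+ v) ⟩
    + (u ℕ.+ v)               ≡⟨ ℤ.pos-+ u v ⟩
    + u + + v                 ≡⟨ cong (λ i → + u + + toℕ (a i)) next-index ⟩
    addShift 1 (lift a) x     ∎
    where
    open ≈-Reasoning
    u = toℕ (a (x mod n))
    v = toℕ (a (sucMod n (x mod n)))
    next-index : sucMod n (x mod n) ≡ (x ℕ.+ 1) mod n
    next-index = trans (sucMod-mod x) (cong (_mod n) (ℕ.+-comm 1 x))

  lift-iterT : ∀ t a → lift (iterT p n t a) ≋ fold (lift a) (addShift 1) t
  lift-iterT zero    a = ≋-refl
  lift-iterT (suc t) a = ≋-trans (lift-T (iterT p n t a)) (addShift-congruent 1 (lift-iterT t a))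

  lift-≗⇒≋ : ∀ {a b} → a ≗ b → lift a ≋ lift b
  lift-≗⇒≋ a≗b x = ≈-reflexive (cong (λ i → + toℕ i) (a≗b (x mod n)))

  lift-≋⇒≗ : ∀ {a b} → lift a ≋ lift b → a ≗ b
  lift-≋⇒≗ {a} {b} la≋lb i = Fin.toℕ-injective (+-≈-injective (Fin.toℕ<n (a i)) (Fin.toℕ<n (b i))
    (subst (λ j → + toℕ (a j) ≈ + toℕ (b j)) (mod-toℕ i) (la≋lb (toℕ i))))

  module _ (P : Tuple p n → Set) (T-preserves : ∀ a → P a → P (T p n a))
           (T-injective : ∀ {a b} → P a → P b → T p n a ≗ T p n b → a ≗ b) where

    iterT-preserves : ∀ t {a} → P a → P (iterT p n t a)
    iterT-preserves zero    Pa = Pa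
    iterT-preserves (suc t) Pa = T-preserves _ (iterT-preserves t Pa)

    iterT-cancel : ∀ {a} → P a → ∀ u e → iterT p n u a ≗ iterT p n (u ℕ.+ e) a → a ≗ iterT p n e a
    iterT-cancel Pa zero    e same = same
    iterT-cancel Pa (suc u) e same =
      iterT-cancel Pa u e (T-injective (iterT-preserves u Pa) (iterT-preserves (u ℕ.+ e) Pa) same)

    injective-on-invariant⇒InCycle : ∀ {a} → P a → InCycle p n a
    injective-on-invariant⇒InCycle {a} Pa
      with i , j , i<j , same ← Fin.pigeonhole (ℕ.n<1+n (p ^ n)) (λ t → funToFin (iterT p n (toℕ t) a)) =
      toℕ j ℕ.∸ toℕ i , ℕ.m<n⇒0<n∸m i<j ,
      λ x → sym (iterT-cancel Pa (toℕ i) (toℕ j ℕ.∸ toℕ i) orbit-repeats x)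
      where
      orbit-repeats : iterT p n (toℕ i) a ≗ iterT p n (toℕ i ℕ.+ (toℕ j ℕ.∸ toℕ i)) a
      orbit-repeats x = begin
        iterT p n (toℕ i) a x                         ≡⟨ Fin.finToFun-funToFin _ x ⟨
        finToFun (funToFin (iterT p n (toℕ i) a)) x  ≡⟨ cong (λ c → finToFun c x) same ⟩
        finToFun (funToFin (iterT p n (toℕ j) a)) x  ≡⟨ Fin.finToFun-funToFin _ x ⟩
        iterT p n (toℕ j) a x                         ≡⟨ cong (λ t → iterT p n t a x) i+[j∸i]≡j ⟨
        iterT p n (toℕ i ℕ.+ (toℕ j ℕ.∸ toℕ i)) a x  ∎
        where
        open ≡-Reasoning
        i+[j∸i]≡j = ℕ.m+[n∸m]≡n (ℕ.<⇒≤ i<j)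

module Characterisation (p n r k : ℕ) .{{_ : NonZero p}} .{{_ : NonZero n}}
            (p-prime : Prime p) (n≡p^r*k : n ≡ p ^ r ℕ.* k)
            (sgn[p^r]≡-1 : sgn (p ^ r) ≡ -1ℤ) (sgn[k]≡1 : sgn k ≡ 1ℤ) (p∤k : ¬ p ℕ.∣ k) where
  open Congruence p
  open AlternatingSum (p ^ r) k
  open Tuples p n

  altSum-cong : ∀ j {g h} → g ≋ h → altSum j g ≈ altSum j h
  altSum-cong j g≋h = sumℤ-cong≈ k (λ i _ → *-congˡ (sgn i) (g≋h _))

  -- altSum j (lift a) unfolds to σ p n r k j a, so REven is the paper's r-evenness.
  REven : Tuple p n → Set
  REven a = ∀ j → j ℕ.< p ^ r → altSum j (lift a) ≈ 0ℤ

  lift-periodic′ : ∀ a → Periodic (p ^ r ℕ.* k) (lift a)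
  lift-periodic′ a = subst (λ N → Periodic N (lift a)) n≡p^r*k (lift-periodic a)

  InCycle⇒REven : ∀ {a} → InCycle p n a → REven a
  InCycle⇒REven (zero , () , _)
  InCycle⇒REven {a} (suc J , _ , cycle) j _ = begin
    altSum j g                     ≈⟨ altSum-cong j g≋A^m[h] ⟩
    altSum j (fold h A m)          ≈⟨ altSum-cong j (frobenius-^ p-prime r h) ⟩
    altSum j (addShift m h)        ≡⟨ altSum-addShift-period sgn[k]≡1 h-periodic j ⟩
    0ℤ                             ∎
    where
    open ≈-Reasoning
    m = p ^ r
    A = addShift 1
    g = lift a
    h = fold g A (m ℕ.* J)
    h-periodic : Periodic (m ℕ.* k) h
    h-periodic = fold-preserves (Periodic (m ℕ.* k)) (addShift-periodic 1) (lift-periodic′ a) (m ℕ.* J)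
    g≋A^[1+J]g : g ≋ fold g A (suc J)
    g≋A^[1+J]g = ≋-trans (lift-≗⇒≋ {a} (sym ∘ cycle)) (lift-iterT (suc J) a)
    g≋A^m[h] : g ≋ fold h A m
    g≋A^m[h] = subst (g ≋_) (trans (cong (fold g A) (ℕ.*-suc m J)) (fold-+ g A m))
                     (fold-cycle (addShift-congruent 1) (suc J) g≋A^[1+J]g m)

  addShift-injective : ∀ {g h} → addShift 1 g ≋ addShift 1 h → altSum 0 g ≈ altSum 0 h → g ≋ h
  addShift-injective {g} {h} Ag≋Ah σg≈σh x = x-y≈0⇒x≈y (begin
    δ x             ≈⟨ alternating δ δ-anti x ⟩
    sgn x * δ 0     ≈⟨ *-congˡ (sgn x) δ0≈0 ⟩
    sgn x * 0ℤ      ≡⟨ ℤ.*-zeroʳ (sgn x) ⟩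
    0ℤ              ∎)
    where
    open ≈-Reasoning
    δ : Seq
    δ y = g y - h y
    δ-anti : ∀ y → δ y + δ (y ℕ.+ 1) ≈ 0ℤ
    δ-anti y = subst (_≈ 0ℤ) (regroup (g y) (g (y ℕ.+ 1)) (h y) (h (y ℕ.+ 1))) (x≈y⇒x-y≈0 (Ag≋Ah y))
      where
      regroup : ∀ a a′ b b′ → a + a′ - (b + b′) ≡ a - b + (a′ - b′)
      regroup = solve-∀
    kδ0≈0 : + k * δ 0 ≈ 0ℤ
    kδ0≈0 = begin
      + k * δ 0                          ≡⟨ altSum-alternating sgn[p^r]≡-1 (δ 0) ⟨
      altSum 0 (λ y → sgn y * δ 0)       ≈⟨ altSum-cong 0 (λ y → ≈-sym (alternating δ δ-anti y)) ⟩
      altSum 0 δ                         ≡⟨ altSum-sub 0 g h ⟩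
      altSum 0 g - altSum 0 h            ≈⟨ x≈y⇒x-y≈0 σg≈σh ⟩
      0ℤ                                 ∎
    δ0≈0 : δ 0 ≈ 0ℤ
    δ0≈0 = *-cancelˡ-≈0 p-prime p∤k (δ 0) kδ0≈0

  T-preserves-REven : ∀ a → REven a → REven (T p n a)
  T-preserves-REven a a-even j j<m = begin
    altSum j (lift (T p n a))         ≈⟨ altSum-cong j (lift-T a) ⟩
    altSum j (addShift 1 g)           ≡⟨ altSum-addShift 1 j g ⟩
    altSum j g + altSum (j ℕ.+ 1) g   ≈⟨ +-cong (a-even j j<m) next≈0 ⟩
    0ℤ                                ∎
    where
    open ≈-Reasoning
    g = lift a
    next≈0 : altSum (j ℕ.+ 1) g ≈ 0ℤ
    next≈0 = subst (λ i → altSum i g ≈ 0ℤ) (ℕ.+-comm 1 j) suc-j≈0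
      where
      suc-j≈0 : altSum (suc j) g ≈ 0ℤ
      suc-j≈0 with ℕ.m≤n⇒m<n∨m≡n j<m
      ... | inj₁ 1+j<m = a-even (suc j) 1+j<m
      ... | inj₂ 1+j≡m = subst (λ i → altSum i g ≈ 0ℤ) (sym 1+j≡m)
                           (≈-trans (≈-reflexive (altSum-antiperiodic sgn[k]≡1 (lift-periodic′ a)))
                                    (-‿cong (a-even 0 (ℕ.m^n>0 p r))))

  T-injective-on-REven : ∀ {a b} → REven a → REven b → T p n a ≗ T p n b → a ≗ b
  T-injective-on-REven {a} {b} a-even b-even Ta≗Tb =
    lift-≋⇒≗ (addShift-injective shifted≋ (≈-trans (a-even 0 m>0) (≈-sym (b-even 0 m>0))))
    where
    m>0 = ℕ.m^n>0 p r
    shifted≋ : addShift 1 (lift a) ≋ addShift 1 (lift b)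
    shifted≋ = ≋-trans (≋-sym (lift-T a)) (≋-trans (lift-≗⇒≋ Ta≗Tb) (lift-T b))

  REven⇒InCycle : ∀ {a} → REven a → InCycle p n a
  REven⇒InCycle = injective-on-invariant⇒InCycle REven T-preserves-REven T-injective-on-REven

theorem6p5 : (p n r k : ℕ) → .{{_ : NonZero p}} → .{{_ : NonZero n}} →
    Prime p → 2 ℕ.< p → 2 ℕ.∣ n → n ≡ p ^ r ℕ.* k → ¬ (p ℕ.∣ k) →
    (a : Tuple p n) →
    InCycle p n a ⇔ (∀ j → j ℕ.< p ^ r → (+ p) ℤD.∣ σ p n r k j a)
theorem6p5 p n r k p-prime 2<p 2∣n n≡p^r*k p∤k a =
  mk⇔ (λ cycle j j<m → Equivalence.to ≈0⇔∣ (InCycle⇒REven cycle j j<m))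
      (λ σ≡0 → REven⇒InCycle (λ j j<m → Equivalence.from ≈0⇔∣ (σ≡0 j j<m)))
  where
  p^r-odd : ¬ 2 ℕ.∣ p ^ r
  p^r-odd = odd-prime-power p-prime 2<p r
  2∣k : 2 ℕ.∣ k
  2∣k with euclidsLemma (p ^ r) k prime[2] (subst (2 ℕ.∣_) n≡p^r*k 2∣n)
  ... | inj₁ 2∣p^r = contradiction 2∣p^r p^r-odd
  ... | inj₂ 2∣k   = 2∣k
  open Congruence p using (≈0⇔∣)
  open Characterisation p n r k p-prime n≡p^r*k (2∤⇒sgn≡-1 (p ^ r) p^r-odd) (2∣⇒sgn≡1 2∣k) p∤k
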